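{- Each of the following holds. (i) For any positive integer $b\neq 2$, there exists a gcd-closed set $S_1$ with $|S_1|=4$ and $\max_{x\in S_1}|G_{S_1}(x)|=2$ which does not satisfy the condition $\mathcal{G}$, such that $(S_1)\mid(S_1^b)$ holds in $M_4(\mathbb{Z})$. (ii) For $b=3$, or for any integer $b\ge 4$ with $b\not\equiv 1,5\pmod 6$, there exists a gcd-closed set $S_2$ with $|S_2|=4$ and $\max_{x\in S_2}|G_{S_2}(x)|=2$ which does not satisfy the condition $\mathcal{G}$, such that $(S_2)\mid[S_2^b]$ holds in $M_4(\mathbb{Z})$. (iii) There exist an integer $b>1$ and a gcd-closed set $S_3$ with $\max_{x\in S_3}|G_{S_3}(x)|=2$, $|S_3|\in\{4,5\}$, which does not satisfy the condition $\mathcal{G}$, such that $[S_3]\mid[S_3^b]$ holds in $M_{|S_3|}(\mathbb{Z})$.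
   Context: For positive integers $x,y$, $(x,y)$ and $[x,y]$ denote their gcd and lcm. A finite set $S=\{x_1,\dots,x_n\}$ of distinct positive integers is gcd closed if $(x_i,x_j)\in S$ for all $i,j$. For a positive integer $a$, $(S^a)$ denotes the $n\times n$ matrix with $(i,j)$-entry $(x_i,x_j)^a$ and $[S^a]$ the $n\times n$ matrix with $(i,j)$-entry $[x_i,x_j]^a$; $(S)=(S^1)$ and $[S]=[S^1]$. For $x,y\in S$ with $x<y$, $x$ is a greatest-type divisor of $y$ in $S$ if $x\mid y$ and whenever $d\in S$ with $x\mid d\mid y$ then $d\in\{x,y\}$; $G_S(y)$ is the set of greatest-type divisors of $y$ in $S$. Two distinct elements $y_1,y_2\in G_S(x)$ satisfy condition $\mathcal{G}$ if $[y_1,y_2]=x$ and $(y_1,y_2)\in G_S(y_1)\cap G_S(y_2)$; $x$ satisfies condition $\mathcal{G}$ if any two distinct elements of $G_S(x)$ satisfy it; a set $S$ satisfies condition $\mathcal{G}$ if every $x\in S$ has either $|G_S(x)|\le1$, or $|G_S(x)|\ge2$ and $x$ satisfies condition $\mathcal{G}$. For $A,B\in M_n(\mathbb{Z})$, $A\mid B$ in $M_n(\mathbb{Z})$ means there exists $C\in M_n(\mathbb{Z})$ with $B=AC$ or $B=CA$. -}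

module Defs where

open import Data.Nat using (ℕ; zero; suc; _<_; _≤_; _^_; _<?_; _≟_)
open import Data.Nat.Divisibility using (_∣_; _∣?_)
open import Data.Nat.GCD using (gcd)
open import Data.Nat.LCM using (lcm)
open import Data.Fin using (Fin; zero; suc)
open import Data.Fin.Properties using (all?)
open import Data.Vec using (allFin; count)
open import Data.Integer using (ℤ; +_) renaming (_+_ to _+ℤ_; _*_ to _*ℤ_)
open import Data.Product using (Σ; ∃; _×_; _,_)
open import Data.Sum using (_⊎_)
open import Relation.Binary.PropositionalEquality using (_≡_; _≢_)
open import Relation.Nullary using (Dec; ¬_)
open import Relation.Nullary.Decidable using (_×-dec_; _⊎-dec_; _→-dec_)
open import Function.Definitions using (Injective)

-- A finite set S = {x_1,...,x_n} of distinct positive integers,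
-- given as an injective enumeration Fin n → ℕ with positive values.
IsPosSet : ∀ {n} → (Fin n → ℕ) → Set
IsPosSet {n} S = Injective _≡_ _≡_ S × (∀ i → 0 < S i)

GcdClosed : ∀ {n} → (Fin n → ℕ) → Set
GcdClosed {n} S = ∀ i j → ∃ λ k → S k ≡ gcd (S i) (S j)

IsGTD : ∀ {n} → (Fin n → ℕ) → Fin n → Fin n → Set
IsGTD {n} S j i =
  (S j < S i) × (S j ∣ S i) ×
  (∀ k → S j ∣ S k → S k ∣ S i → (S k ≡ S j) ⊎ (S k ≡ S i))

isGTD? : ∀ {n} (S : Fin n → ℕ) j i → Dec (IsGTD S j i)
isGTD? S j i =
  (S j <? S i) ×-dec (S j ∣? S i) ×-dec
  all? (λ k → (S j ∣? S k) →-dec ((S k ∣? S i) →-dec ((S k ≟ S j) ⊎-dec (S k ≟ S i))))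

cardG : ∀ {n} → (Fin n → ℕ) → Fin n → ℕ
cardG {n} S i = count (λ j → isGTD? S j i) (allFin n)

MaxCardG : ∀ {n} → (Fin n → ℕ) → ℕ → Set
MaxCardG {n} S m = (∀ i → cardG S i ≤ m) × (∃ λ i → cardG S i ≡ m)

PairG : ∀ {n} → (Fin n → ℕ) → Fin n → Fin n → Fin n → Set
PairG {n} S i j k =
  (lcm (S j) (S k) ≡ S i) ×
  (∃ λ l → (S l ≡ gcd (S j) (S k)) × IsGTD S l j × IsGTD S l k)

PointG : ∀ {n} → (Fin n → ℕ) → Fin n → Set
PointG {n} S i = ∀ j k → IsGTD S j i → IsGTD S k i → S j ≢ S k → PairG S i j k

SatG : ∀ {n} → (Fin n → ℕ) → Set
SatG {n} S = ∀ i → (cardG S i ≤ 1) ⊎ ((2 ≤ cardG S i) × PointG S i)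

Mat : ℕ → Set
Mat n = Fin n → Fin n → ℤ

∑ : ∀ n → (Fin n → ℤ) → ℤ
∑ zero    f = + 0
∑ (suc n) f = f zero +ℤ ∑ n (λ i → f (suc i))

_⊗_ : ∀ {n} → Mat n → Mat n → Mat n
_⊗_ {n} A B i j = ∑ n (λ k → A i k *ℤ B k j)

_≈M_ : ∀ {n} → Mat n → Mat n → Set
A ≈M B = ∀ i j → A i j ≡ B i j

_∣M_ : ∀ {n} → Mat n → Mat n → Set
_∣M_ {n} A B = ∃ λ (C : Mat n) → (B ≈M (A ⊗ C)) ⊎ (B ≈M (C ⊗ A))

gcdMat : ∀ {n} → (Fin n → ℕ) → ℕ → Mat n
gcdMat S a i j = + (gcd (S i) (S j) ^ a)

lcmMat : ∀ {n} → (Fin n → ℕ) → ℕ → Mat n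
lcmMat S a i j = + (lcm (S i) (S j) ^ a)

Admissible : ∀ {n} → (Fin n → ℕ) → Set
Admissible S = IsPosSet S × GcdClosed S × MaxCardG S 2 × ¬ SatG S

{-# OPTIONS --safe #-}
-- S = {2, 4, 6, 24} is a diamond under divisibility (2 below 4 and 6, which are below 24),
-- and G_S(24) = {4, 6} with [4, 6] = 12 ≠ 24, so condition 𝒢 fails.  On a diamond every
-- matrix (f (x_i, x_j)) factors as ζ · diag (μ f) · ζᵀ with ζ the unimodular zeta matrix
-- and μ f the Möbius inversion of f; for (S) the diagonal is (2, 2, 4, 16).  Hence
-- (S) ∣ M once, in every column of M, the k-th Möbius coefficient is divisible by the
-- k-th diagonal entry.  For b ≥ 3 write 2^b = 8x and 3^b = 1 + 2q: every entry of (S^b)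
-- and [S^b] is a monomial (2^b)^m (3^b)^n, so these divisibilities become polynomial
-- identities in x and q; b = 1, 2 and the example S₃ = {2, 4, 6, 36} are finite checks.
module Submission where

open import Defs
open import Algebra.Properties.CommutativeSemigroup using (interchange)
open import Data.Fin using (Fin)
import Data.Fin as Fin
open import Data.Fin.Patterns using (0F; 1F; 2F; 3F)
open import Data.Fin.Properties using (all?; any?)
open import Data.Integer using (ℤ; +_; -_; 0ℤ; _+_; _-_; _*_)
import Data.Integer as ℤ
open import Data.Integer.Divisibility.Signed using (_∣_; divides; _∣?_; ∣-refl)
open import Data.Integer.Properties using (pos-*; +-inverseʳ)
open import Data.Integer.Tactic.RingSolver using (solve-∀; ring)
open import Data.Nat as ℕ using (ℕ; zero; suc; _≤_; _<_; _%_; _⊔_; s≤s; z≤n; _≤?_)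
import Data.Nat.Properties as ℕ
open import Data.Nat.GCD using (gcd)
open import Data.Nat.LCM using (lcm)
open import Data.Product using (Σ; ∃; ∃₂; _×_; _,_)
open import Data.Sum using (_⊎_; inj₁; inj₂)
open import Data.Vec using (Vec; _∷_; []; lookup)
open import Function.Base using (_∘_)
open import Function.Definitions using (Injective)
open import Relation.Binary.PropositionalEquality
  using (_≡_; _≢_; refl; sym; trans; cong; cong₂; module ≡-Reasoning)
open import Relation.Nullary using (Dec; ¬?)
open import Relation.Nullary.Decidable using (map′; from-yes; _×-dec_; _⊎-dec_; _→-dec_)
open import Tactic.RingSolver.Core.AlmostCommutativeRing using (module AlmostCommutativeRing)

-- The ring solver only recognises its own power operator, so monomials are written with it.
open AlmostCommutativeRing ring using (_^_)

injective? : ∀ {n} (S : Fin n → ℕ) → Dec (Injective _≡_ _≡_ S)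
injective? S = map′ (λ inj {i} {j} → inj i j) (λ inj i j → inj)
  (all? λ i → all? λ j → (S i ℕ.≟ S j) →-dec (i Fin.≟ j))

gcdClosed? : ∀ {n} (S : Fin n → ℕ) → Dec (GcdClosed S)
gcdClosed? S = all? λ i → all? λ j → any? λ k → S k ℕ.≟ gcd (S i) (S j)

maxCardG? : ∀ {n} (S : Fin n → ℕ) m → Dec (MaxCardG S m)
maxCardG? S m = (all? λ i → cardG S i ≤? m) ×-dec (any? λ i → cardG S i ℕ.≟ m)

pairG? : ∀ {n} (S : Fin n → ℕ) i j k → Dec (PairG S i j k)
pairG? S i j k = (lcm (S j) (S k) ℕ.≟ S i) ×-dec
  (any? λ l → (S l ℕ.≟ gcd (S j) (S k)) ×-dec isGTD? S l j ×-dec isGTD? S l k)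

pointG? : ∀ {n} (S : Fin n → ℕ) i → Dec (PointG S i)
pointG? S i = all? λ j → all? λ k →
  isGTD? S j i →-dec (isGTD? S k i →-dec (¬? (S j ℕ.≟ S k) →-dec pairG? S i j k))

satG? : ∀ {n} (S : Fin n → ℕ) → Dec (SatG S)
satG? S = all? λ i → (cardG S i ≤? 1) ⊎-dec ((2 ≤? cardG S i) ×-dec pointG? S i)

admissible? : ∀ {n} (S : Fin n → ℕ) → Dec (Admissible S)
admissible? S =
  (injective? S ×-dec all? (λ i → 1 ≤? S i)) ×-dec gcdClosed? S ×-dec maxCardG? S 2 ×-dec ¬? (satG? S)

∑-cong : ∀ n {f g : Fin n → ℤ} → (∀ i → f i ≡ g i) → ∑ n f ≡ ∑ n g
∑-cong zero    f≡g = refl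
∑-cong (suc n) f≡g = cong₂ _+_ (f≡g 0F) (∑-cong n (f≡g ∘ Fin.suc))

⊗-cong : ∀ {n} {A A′ B B′ : Mat n} → A ≈M A′ → B ≈M B′ → (A ⊗ B) ≈M (A′ ⊗ B′)
⊗-cong {n} A≈ B≈ i j = ∑-cong n λ k → cong₂ _*_ (A≈ i k) (B≈ k j)

∣M-resp-≈M : ∀ {n} {A A′ B B′ : Mat n} → A ≈M A′ → B ≈M B′ → A ∣M B → A′ ∣M B′
∣M-resp-≈M A≈ B≈ (C , inj₁ B≈AC) = C , inj₁ λ i j →
  trans (sym (B≈ i j)) (trans (B≈AC i j) (⊗-cong {B = C} A≈ (λ _ _ → refl) i j))
∣M-resp-≈M A≈ B≈ (C , inj₂ B≈CA) = C , inj₂ λ i j →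
  trans (sym (B≈ i j)) (trans (B≈CA i j) (⊗-cong {A = C} (λ _ _ → refl) A≈ i j))

-- Fin 4 indexes the diamond 0 < 1, 2 < 3; for S below, gcd (S i) (S j) = S (meet i j).

meet : Fin 4 → Fin 4 → Fin 4
meet i  3F = i
meet 3F j  = j
meet 1F 1F = 1F
meet 2F 2F = 2F
meet _  _  = 0F

meetMat : (Fin 4 → ℤ) → Mat 4
meetMat f i j = f (meet i j)

μ : (Fin 4 → ℤ) → Fin 4 → ℤ
μ w 0F = w 0F
μ w 1F = w 1F - w 0F
μ w 2F = w 2F - w 0F
μ w 3F = w 3F - w 1F - w 2F + w 0F

ζ : (Fin 4 → ℤ) → Fin 4 → ℤ
ζ w 0F = w 0F
ζ w 1F = w 0F + w 1F
ζ w 2F = w 0F + w 2F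
ζ w 3F = w 0F + w 1F + w 2F + w 3F

μᵀ : (Fin 4 → ℤ) → Fin 4 → ℤ
μᵀ w 0F = w 0F - w 1F - w 2F + w 3F
μᵀ w 1F = w 1F - w 3F
μᵀ w 2F = w 2F - w 3F
μᵀ w 3F = w 3F

μ-cong : ∀ {w w′} → (∀ i → w i ≡ w′ i) → ∀ k → μ w k ≡ μ w′ k
μ-cong e 0F = e 0F
μ-cong e 1F = cong₂ _-_ (e 1F) (e 0F)
μ-cong e 2F = cong₂ _-_ (e 2F) (e 0F)
μ-cong e 3F = cong₂ _+_ (cong₂ _-_ (cong₂ _-_ (e 3F) (e 1F)) (e 2F)) (e 0F)

ζ-cong : ∀ {w w′} → (∀ i → w i ≡ w′ i) → ∀ k → ζ w k ≡ ζ w′ k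
ζ-cong e 0F = e 0F
ζ-cong e 1F = cong₂ _+_ (e 0F) (e 1F)
ζ-cong e 2F = cong₂ _+_ (e 0F) (e 2F)
ζ-cong e 3F = cong₂ _+_ (cong₂ _+_ (cong₂ _+_ (e 0F) (e 1F)) (e 2F)) (e 3F)

i+[j-i]≡j : ∀ i j → i + (j - i) ≡ j
i+[j-i]≡j = solve-∀

ζ-μ : ∀ w i → ζ (μ w) i ≡ w i
ζ-μ w 0F = refl
ζ-μ w 1F = i+[j-i]≡j (w 0F) (w 1F)
ζ-μ w 2F = i+[j-i]≡j (w 0F) (w 2F)
ζ-μ w 3F = inv (w 0F) (w 1F) (w 2F) (w 3F)
  where inv : ∀ a b c d → a + (b - a) + (c - a) + (d - b - c + a) ≡ d
        inv = solve-∀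

-- Smith's factorisation meetMat f = ζ · diag (μ f) · ζᵀ, multiplied on the right by
-- (ζᵀ)⁻¹ = μᵀ.
meetMat-mul-μᵀ : ∀ f q i → ∑ 4 (λ k → meetMat f i k * μᵀ q k) ≡ ζ (λ l → q l * μ f l) i
meetMat-mul-μᵀ f q 0F = id₀ (f 0F) (q 0F) (q 1F) (q 2F) (q 3F)
  where id₀ : ∀ f₀ q₀ q₁ q₂ q₃ →
          f₀ * (q₀ - q₁ - q₂ + q₃) + (f₀ * (q₁ - q₃) + (f₀ * (q₂ - q₃) + (f₀ * q₃ + + 0)))
            ≡ q₀ * f₀
        id₀ = solve-∀
meetMat-mul-μᵀ f q 1F = id₁ (f 0F) (f 1F) (q 0F) (q 1F) (q 2F) (q 3F)
  where id₁ : ∀ f₀ f₁ q₀ q₁ q₂ q₃ →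
          f₀ * (q₀ - q₁ - q₂ + q₃) + (f₁ * (q₁ - q₃) + (f₀ * (q₂ - q₃) + (f₁ * q₃ + + 0)))
            ≡ q₀ * f₀ + q₁ * (f₁ - f₀)
        id₁ = solve-∀
meetMat-mul-μᵀ f q 2F = id₂ (f 0F) (f 2F) (q 0F) (q 1F) (q 2F) (q 3F)
  where id₂ : ∀ f₀ f₂ q₀ q₁ q₂ q₃ →
          f₀ * (q₀ - q₁ - q₂ + q₃) + (f₀ * (q₁ - q₃) + (f₂ * (q₂ - q₃) + (f₂ * q₃ + + 0)))
            ≡ q₀ * f₀ + q₂ * (f₂ - f₀)
        id₂ = solve-∀
meetMat-mul-μᵀ f q 3F = id₃ (f 0F) (f 1F) (f 2F) (f 3F) (q 0F) (q 1F) (q 2F) (q 3F)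
  where id₃ : ∀ f₀ f₁ f₂ f₃ q₀ q₁ q₂ q₃ →
          f₀ * (q₀ - q₁ - q₂ + q₃) + (f₁ * (q₁ - q₃) + (f₂ * (q₂ - q₃) + (f₃ * q₃ + + 0)))
            ≡ q₀ * f₀ + q₁ * (f₁ - f₀) + q₂ * (f₂ - f₀) + q₃ * (f₃ - f₁ - f₂ + f₀)
        id₃ = solve-∀

infix 4 _∣μ_

_∣μ_ : (Fin 4 → ℤ) → (Fin 4 → ℤ) → Set
f ∣μ w = ∀ k → μ f k ∣ μ w k

∣μ-cong : ∀ {f w w′} → (∀ i → w i ≡ w′ i) → f ∣μ w′ → f ∣μ w
∣μ-cong w≡w′ f∣w′ k with f∣w′ k
... | divides q eq = divides q (trans (μ-cong w≡w′ k) eq)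

meetMat-∣M : ∀ f M → (∀ j → f ∣μ (λ i → M i j)) → meetMat f ∣M M
meetMat-∣M f M f∣M = C , inj₁ λ i j → begin
    M i j                               ≡⟨ ζ-μ (λ i → M i j) i ⟨
    ζ (μ (λ i → M i j)) i               ≡⟨ ζ-cong (λ l → _∣_.equality (f∣M j l)) i ⟩
    ζ (λ l → Q l j * μ f l) i           ≡⟨ meetMat-mul-μᵀ f (λ l → Q l j) i ⟨
    (meetMat f ⊗ C) i j                 ∎
  where
  open ≡-Reasoning
  Q : Mat 4
  Q l j = _∣_.quotient (f∣M j l)
  C : Mat 4
  C k j = μᵀ (λ l → Q l j) k

i-i-j+j≡0 : ∀ i j → i - i - j + j ≡ 0ℤ
i-i-j+j≡0 = solve-∀

i-j-i+j≡0 : ∀ i j → i - j - i + j ≡ 0ℤ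
i-j-i+j≡0 = solve-∀

≡0⇒∣ : ∀ {k m} → m ≡ 0ℤ → k ∣ m
≡0⇒∣ m≡0 = divides 0ℤ m≡0

meetMat-∣M-meetMat : ∀ {f g} → f ∣μ g → meetMat f ∣M meetMat g
meetMat-∣M-meetMat {f} {g} f∣g = meetMat-∣M f (meetMat g) column
  where
  column : ∀ j → f ∣μ (λ i → g (meet i j))
  column 3F    = f∣g
  column 0F 0F = f∣g 0F
  column 0F 1F = ≡0⇒∣ (+-inverseʳ (g 0F))
  column 0F 2F = ≡0⇒∣ (+-inverseʳ (g 0F))
  column 0F 3F = ≡0⇒∣ (i-i-j+j≡0 (g 0F) (g 0F))
  column 1F 0F = f∣g 0F
  column 1F 1F = f∣g 1F
  column 1F 2F = ≡0⇒∣ (+-inverseʳ (g 0F))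
  column 1F 3F = ≡0⇒∣ (i-i-j+j≡0 (g 1F) (g 0F))
  column 2F 0F = f∣g 0F
  column 2F 1F = ≡0⇒∣ (+-inverseʳ (g 0F))
  column 2F 2F = f∣g 2F
  column 2F 3F = ≡0⇒∣ (i-j-i+j≡0 (g 2F) (g 0F))

^-distribʳ-* : ∀ m n b → (m ℕ.* n) ℕ.^ b ≡ m ℕ.^ b ℕ.* n ℕ.^ b
^-distribʳ-* m n zero    = refl
^-distribʳ-* m n (suc b) = begin
  m ℕ.* n ℕ.* (m ℕ.* n) ℕ.^ b           ≡⟨ cong (m ℕ.* n ℕ.*_) (^-distribʳ-* m n b) ⟩
  m ℕ.* n ℕ.* (m ℕ.^ b ℕ.* n ℕ.^ b)     ≡⟨ interchange ℕ.*-commutativeSemigroup m n _ _ ⟩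
  m ℕ.* m ℕ.^ b ℕ.* (n ℕ.* n ℕ.^ b)     ∎
  where open ≡-Reasoning

^-swap : ∀ m n b → (m ℕ.^ n) ℕ.^ b ≡ (m ℕ.^ b) ℕ.^ n
^-swap m n b = begin
  (m ℕ.^ n) ℕ.^ b  ≡⟨ ℕ.^-*-assoc m n b ⟩
  m ℕ.^ (n ℕ.* b)  ≡⟨ cong (m ℕ.^_) (ℕ.*-comm n b) ⟩
  m ℕ.^ (b ℕ.* n)  ≡⟨ ℕ.^-*-assoc m b n ⟨
  (m ℕ.^ b) ℕ.^ n  ∎
  where open ≡-Reasoning

pos-^ : ∀ m n → + (m ℕ.^ n) ≡ (+ m) ^ n
pos-^ m 0             = refl
pos-^ m 1             = cong +_ (ℕ.*-identityʳ m)
pos-^ m (suc (suc n)) = begin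
  + (m ℕ.* m ℕ.^ suc n)  ≡⟨ cong +_ (ℕ.*-comm m (m ℕ.^ suc n)) ⟩
  + (m ℕ.^ suc n ℕ.* m)  ≡⟨ pos-* (m ℕ.^ suc n) m ⟩
  + (m ℕ.^ suc n) * + m  ≡⟨ cong (_* + m) (pos-^ m (suc n)) ⟩
  (+ m) ^ suc n * + m    ∎
  where open ≡-Reasoning

pos-monomial : ∀ p r m n b →
  + ((p ℕ.^ m ℕ.* r ℕ.^ n) ℕ.^ b) ≡ (+ (p ℕ.^ b)) ^ m * (+ (r ℕ.^ b)) ^ n
pos-monomial p r m n b = begin
  + ((p ℕ.^ m ℕ.* r ℕ.^ n) ℕ.^ b)             ≡⟨ cong +_ (^-distribʳ-* (p ℕ.^ m) (r ℕ.^ n) b) ⟩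
  + ((p ℕ.^ m) ℕ.^ b ℕ.* (r ℕ.^ n) ℕ.^ b)     ≡⟨ cong +_ (cong₂ ℕ._*_ (^-swap p m b) (^-swap r n b)) ⟩
  + ((p ℕ.^ b) ℕ.^ m ℕ.* (r ℕ.^ b) ℕ.^ n)     ≡⟨ pos-* ((p ℕ.^ b) ℕ.^ m) _ ⟩
  + ((p ℕ.^ b) ℕ.^ m) * + ((r ℕ.^ b) ℕ.^ n)   ≡⟨ cong₂ _*_ (pos-^ _ m) (pos-^ _ n) ⟩
  (+ (p ℕ.^ b)) ^ m * (+ (r ℕ.^ b)) ^ n           ∎
  where open ≡-Reasoning

3^n-odd : ∀ n → ∃ λ q → + (3 ℕ.^ n) ≡ + 1 + + 2 * q
3^n-odd zero    = 0ℤ , refl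
3^n-odd (suc n) with 3^n-odd n
... | q , 3^n≡1+2q = + 1 + + 3 * q , (begin
  + (3 ℕ.* 3 ℕ.^ n)           ≡⟨ pos-* 3 (3 ℕ.^ n) ⟩
  + 3 * + (3 ℕ.^ n)           ≡⟨ cong (+ 3 *_) 3^n≡1+2q ⟩
  + 3 * (+ 1 + + 2 * q)       ≡⟨ step q ⟩
  + 1 + + 2 * (+ 1 + + 3 * q) ∎)
  where
  open ≡-Reasoning
  step : ∀ q → + 3 * (+ 1 + + 2 * q) ≡ + 1 + + 2 * (+ 1 + + 3 * q)
  step = solve-∀

pos-2^[3+n] : ∀ n → + (2 ℕ.^ (3 ℕ.+ n)) ≡ + 8 * + (2 ℕ.^ n)
pos-2^[3+n] n = trans (cong +_ (sym (trans (ℕ.*-assoc 4 2 y) (ℕ.*-assoc 2 2 (2 ℕ.* y))))) (pos-* 8 y)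
  where y = 2 ℕ.^ n

monomial-power-3+ : ∀ c → ∃₂ λ x q → ∀ m n →
  + ((2 ℕ.^ m ℕ.* 3 ℕ.^ n) ℕ.^ (3 ℕ.+ c)) ≡ (+ 8 * x) ^ m * (+ 1 + + 2 * q) ^ n
monomial-power-3+ c with 3^n-odd (3 ℕ.+ c)
... | q , 3^b≡1+2q = + (2 ℕ.^ c) , q , λ m n →
  trans (pos-monomial 2 3 m n (3 ℕ.+ c)) (cong₂ (λ u v → u ^ m * v ^ n) (pos-2^[3+n] c) 3^b≡1+2q)

α β : Fin 4 → ℕ
α 0F = 1
α 1F = 2
α 2F = 1
α 3F = 3
β 0F = 0
β 1F = 0
β 2F = 1
β 3F = 1

-- S = {2, 4, 6, 24}, each element written as 2^α 3^β.
S : Fin 4 → ℕ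
S k = 2 ℕ.^ α k ℕ.* 3 ℕ.^ β k

S-admissible : Admissible S
S-admissible = from-yes (admissible? S)

gcd-S : ∀ i j → gcd (S i) (S j) ≡ S (meet i j)
gcd-S = from-yes (all? λ i → all? λ j → gcd (S i) (S j) ℕ.≟ S (meet i j))

lcm-S : ∀ i j → lcm (S i) (S j) ≡ 2 ℕ.^ (α i ⊔ α j) ℕ.* 3 ℕ.^ (β i ⊔ β j)
lcm-S = from-yes (all? λ i → all? λ j → lcm (S i) (S j) ℕ.≟ 2 ℕ.^ (α i ⊔ α j) ℕ.* 3 ℕ.^ (β i ⊔ β j))

powers : ℕ → Fin 4 → ℤ
powers b k = + (S k ℕ.^ b)

meetMat-powers : ∀ b → meetMat (powers b) ≈M gcdMat S b
meetMat-powers b i j = cong (λ n → + (n ℕ.^ b)) (sym (gcd-S i j))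

powers-∣μ-monomials : ∀ x q → powers 1 ∣μ (λ k → (+ 8 * x) ^ α k * (+ 1 + + 2 * q) ^ β k)
powers-∣μ-monomials x q 0F = divides (+ 4 * x) (μ₀ x q)
  where μ₀ : ∀ x q → let u = + 8 * x ; v = + 1 + + 2 * q in
          u ^ 1 * v ^ 0 ≡ + 4 * x * + 2
        μ₀ = solve-∀
powers-∣μ-monomials x q 1F = divides (+ 32 * x * x - + 4 * x) (μ₁ x q)
  where μ₁ : ∀ x q → let u = + 8 * x ; v = + 1 + + 2 * q in
          u ^ 2 * v ^ 0 - u ^ 1 * v ^ 0 ≡ (+ 32 * x * x - + 4 * x) * + 2
        μ₁ = solve-∀
powers-∣μ-monomials x q 2F = divides (+ 4 * x * q) (μ₂ x q)
  where μ₂ : ∀ x q → let u = + 8 * x ; v = + 1 + + 2 * q in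
          u ^ 1 * v ^ 1 - u ^ 1 * v ^ 0 ≡ + 4 * x * q * + 4
        μ₂ = solve-∀
powers-∣μ-monomials x q 3F = divides (x * (+ 8 * x - + 1) * (+ 4 * x + + 8 * x * q + q)) (μ₃ x q)
  where μ₃ : ∀ x q → let u = + 8 * x ; v = + 1 + + 2 * q in
          u ^ 3 * v ^ 1 - u ^ 2 * v ^ 0 - u ^ 1 * v ^ 1 + u ^ 1 * v ^ 0
            ≡ x * (+ 8 * x - + 1) * (+ 4 * x + + 8 * x * q + q) * + 16
        μ₃ = solve-∀

-- Column 0 of [S^b] is the vector of the S k ^ b, and column 3 is constant.
lcm-columns-∣μ : ∀ x q j →
  powers 1 ∣μ (λ i → (+ 8 * x) ^ (α i ⊔ α j) * (+ 1 + + 2 * q) ^ (β i ⊔ β j))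
lcm-columns-∣μ x q 0F 0F = powers-∣μ-monomials x q 0F
lcm-columns-∣μ x q 0F 1F = powers-∣μ-monomials x q 1F
lcm-columns-∣μ x q 0F 2F = powers-∣μ-monomials x q 2F
lcm-columns-∣μ x q 0F 3F = powers-∣μ-monomials x q 3F
lcm-columns-∣μ x q 1F 0F = divides (+ 32 * x * x) (col₁-μ₀ x q)
  where col₁-μ₀ : ∀ x q → let u = + 8 * x ; v = + 1 + + 2 * q in
          u ^ 2 * v ^ 0 ≡ + 32 * x * x * + 2
        col₁-μ₀ = solve-∀
lcm-columns-∣μ x q 1F 1F = ≡0⇒∣ (+-inverseʳ ((+ 8 * x) ^ 2 * (+ 1 + + 2 * q) ^ 0))
lcm-columns-∣μ x q 1F 2F = divides (+ 32 * x * x * q) (col₁-μ₂ x q)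
  where col₁-μ₂ : ∀ x q → let u = + 8 * x ; v = + 1 + + 2 * q in
          u ^ 2 * v ^ 1 - u ^ 2 * v ^ 0 ≡ + 32 * x * x * q * + 4
        col₁-μ₂ = solve-∀
lcm-columns-∣μ x q 1F 3F = divides (+ 4 * x * x * (+ 1 + + 2 * q) * (+ 8 * x - + 1)) (col₁-μ₃ x q)
  where col₁-μ₃ : ∀ x q → let u = + 8 * x ; v = + 1 + + 2 * q in
          u ^ 3 * v ^ 1 - u ^ 2 * v ^ 0 - u ^ 2 * v ^ 1 + u ^ 2 * v ^ 0
            ≡ + 4 * x * x * v * (+ 8 * x - + 1) * + 16
        col₁-μ₃ = solve-∀
lcm-columns-∣μ x q 2F 0F = divides (+ 4 * x * (+ 1 + + 2 * q)) (col₂-μ₀ x q)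
  where col₂-μ₀ : ∀ x q → let u = + 8 * x ; v = + 1 + + 2 * q in
          u ^ 1 * v ^ 1 ≡ + 4 * x * v * + 2
        col₂-μ₀ = solve-∀
lcm-columns-∣μ x q 2F 1F = divides (+ 4 * x * (+ 1 + + 2 * q) * (+ 8 * x - + 1)) (col₂-μ₁ x q)
  where col₂-μ₁ : ∀ x q → let u = + 8 * x ; v = + 1 + + 2 * q in
          u ^ 2 * v ^ 1 - u ^ 1 * v ^ 1 ≡ + 4 * x * v * (+ 8 * x - + 1) * + 2
        col₂-μ₁ = solve-∀
lcm-columns-∣μ x q 2F 2F = ≡0⇒∣ (+-inverseʳ ((+ 8 * x) ^ 1 * (+ 1 + + 2 * q) ^ 1))
lcm-columns-∣μ x q 2F 3F = divides (+ 4 * x * x * (+ 1 + + 2 * q) * (+ 8 * x - + 1)) (col₂-μ₃ x q)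
  where col₂-μ₃ : ∀ x q → let u = + 8 * x ; v = + 1 + + 2 * q in
          u ^ 3 * v ^ 1 - u ^ 2 * v ^ 1 - u ^ 1 * v ^ 1 + u ^ 1 * v ^ 1
            ≡ + 4 * x * x * v * (+ 8 * x - + 1) * + 16
        col₂-μ₃ = solve-∀
lcm-columns-∣μ x q 3F 0F = divides (+ 256 * x * x * x * (+ 1 + + 2 * q)) (col₃-μ₀ x q)
  where col₃-μ₀ : ∀ x q → let u = + 8 * x ; v = + 1 + + 2 * q in
          u ^ 3 * v ^ 1 ≡ + 256 * x * x * x * v * + 2
        col₃-μ₀ = solve-∀
lcm-columns-∣μ x q 3F 1F = ≡0⇒∣ (+-inverseʳ ((+ 8 * x) ^ 3 * (+ 1 + + 2 * q) ^ 1))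
lcm-columns-∣μ x q 3F 2F = ≡0⇒∣ (+-inverseʳ ((+ 8 * x) ^ 3 * (+ 1 + + 2 * q) ^ 1))
lcm-columns-∣μ x q 3F 3F = ≡0⇒∣ (i-i-j+j≡0 c c)
  where c = (+ 8 * x) ^ 3 * (+ 1 + + 2 * q) ^ 1

powers-∣μ-powers : ∀ {b} → 1 ≤ b → powers 1 ∣μ powers b
powers-∣μ-powers {1} _ k = ∣-refl
powers-∣μ-powers {2} _ = from-yes (all? λ k → μ (powers 1) k ∣? μ (powers 2) k)
powers-∣μ-powers {suc (suc (suc c))} _ =
  let x , q , monomial = monomial-power-3+ c in
  ∣μ-cong (λ k → monomial (α k) (β k)) (powers-∣μ-monomials x q)

gcd∣gcd-power : ∀ {b} → 1 ≤ b → gcdMat S 1 ∣M gcdMat S b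
gcd∣gcd-power {b} 1≤b =
  ∣M-resp-≈M (meetMat-powers 1) (meetMat-powers b) (meetMat-∣M-meetMat (powers-∣μ-powers 1≤b))

gcd∣lcm-power : ∀ {b} → 3 ≤ b → gcdMat S 1 ∣M lcmMat S b
gcd∣lcm-power {suc (suc (suc c))} (s≤s (s≤s (s≤s _))) =
  let x , q , monomial = monomial-power-3+ c in
  ∣M-resp-≈M (meetMat-powers 1) (λ _ _ → refl) (meetMat-∣M (powers 1) (lcmMat S (3 ℕ.+ c)) λ j →
    ∣μ-cong (λ i → trans (cong (λ n → + (n ℕ.^ (3 ℕ.+ c))) (lcm-S i j)) (monomial (α i ⊔ α j) (β i ⊔ β j)))
            (lcm-columns-∣μ x q j))

S₃ : Fin 4 → ℕ
S₃ = lookup (2 ∷ 4 ∷ 6 ∷ 36 ∷ [])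

S₃-admissible : Admissible S₃
S₃-admissible = from-yes (admissible? S₃)

-- C₃ = [S₃]⁻¹ [S₃²], which happens to be integral.
C₃ : Mat 4
C₃ i j = lookup (lookup rows i) j
  where
  rows : Vec (Vec ℤ 4) 4
  rows = (+ 138 ∷ + 96 ∷ + 90 ∷ + 0 ∷ [])
       ∷ (- + 65 ∷ - + 32 ∷ - + 45 ∷ + 0 ∷ [])
       ∷ (- + 44 ∷ - + 32 ∷ - + 12 ∷ + 0 ∷ [])
       ∷ (+ 7 ∷ + 4 ∷ + 3 ∷ + 36 ∷ [])
       ∷ []

lcm∣lcm-square : lcmMat S₃ 1 ∣M lcmMat S₃ 2
lcm∣lcm-square = C₃ , inj₁ (from-yes (all? λ i → all? λ j → lcmMat S₃ 2 i j ℤ.≟ (lcmMat S₃ 1 ⊗ C₃) i j))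

theorem1p3 : ((b : ℕ) → 1 ≤ b → b ≢ 2 →
    Σ (Fin 4 → ℕ) λ S → Admissible S × (gcdMat S 1 ∣M gcdMat S b))
    × ((b : ℕ) → (b ≡ 3 ⊎ (4 ≤ b × b % 6 ≢ 1 × b % 6 ≢ 5)) →
    Σ (Fin 4 → ℕ) λ S → Admissible S × (gcdMat S 1 ∣M lcmMat S b))
    × (∃ λ (b : ℕ) → 1 < b × (∃ λ (n : ℕ) → (n ≡ 4 ⊎ n ≡ 5) ×
    Σ (Fin n → ℕ) λ S → Admissible S × (lcmMat S 1 ∣M lcmMat S b)))
theorem1p3 =
    (λ b 1≤b _ → S , S-admissible , gcd∣gcd-power 1≤b)
  , (λ b b≡3∨b≥4 → S , S-admissible , gcd∣lcm-power (3≤b b≡3∨b≥4))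
  , 2 , s≤s (s≤s z≤n) , 4 , inj₁ refl , S₃ , S₃-admissible , lcm∣lcm-square
  where
  3≤b : ∀ {b} {P : Set} → b ≡ 3 ⊎ (4 ≤ b × P) → 3 ≤ b
  3≤b (inj₁ refl)     = ℕ.≤-refl
  3≤b (inj₂ (4≤b , _)) = ℕ.<⇒≤ 4≤b
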